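{- Let $n=p^mq^m$, where $p,q$ are distinct primes and $m>1$ is an integer. Then the Wiener index of the essential ideal graph $\mathcal{E}_{\mathbb{Z}_n}$ is $\dfrac{m^4+4m^3+3m^2-8m+2}{2}$.
   Context: $\mathbb{Z}_n$ is the ring of integers modulo $n$. An ideal $I$ of a commutative ring $R$ is essential if $I\cap J\neq\{0\}$ for every nonzero ideal $J$ of $R$. The essential ideal graph $\mathcal{E}_{\mathbb{Z}_n}$ is the simple graph whose vertex set is the set of all nonzero proper ideals of $\mathbb{Z}_n$, two distinct vertices $I,K$ being adjacent if and only if $I+K$ is an essential ideal of $\mathbb{Z}_n$. For a connected graph $G$ with distance $d$, the Wiener index is $W(G)=\sum_{\{u,v\}} d(u,v)$, summed over unordered pairs of distinct vertices. -}

module Defs where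

-- The ring ℤ_n is modelled with carrier {0,…,n-1} ⊆ ℕ and operations
-- reduced modulo n.  A subset of ℤ_n is a Vec Bool n (entry i = "i ∈ S").
-- All notions below are decidable (finite), so they are given as Bool.

open import Data.Nat using (ℕ; zero; suc; _+_; _*_; _%_; _<_; _≤_; _^_)
open import Data.Bool using (Bool; true; false; _∧_; _∨_; not; if_then_else_)
open import Data.Fin using (Fin; toℕ)
open import Data.Vec using (Vec; []; _∷_; tabulate)
open import Data.List using (List; []; _∷_; map; _++_; filter; length; upTo)
open import Data.Bool.ListAction using (all; any)
open import Data.Nat.ListAction using (sum)
open import Data.Product using (_×_; _,_)
open import Data.Vec.Properties using (≡-dec)
open import Data.Bool.Properties using () renaming (_≟_ to _≟B_)
open import Relation.Nullary.Decidable using (⌊_⌋)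

-- reduction modulo n (n = 0 never occurs below; we then leave a unchanged)
red : ℕ → ℕ → ℕ
red zero    a = a
red (suc k) a = a % suc k

-- membership of a natural number in a subset of ℤ_n (false if out of range)
_∋_ : ∀ {n} → Vec Bool n → ℕ → Bool
[]      ∋ _     = false
(b ∷ _) ∋ zero  = b
(_ ∷ s) ∋ suc x = s ∋ x

_⇒_ : Bool → Bool → Bool
a ⇒ b = not a ∨ b

elems : ℕ → List ℕ
elems n = upTo n

allSubsets : (n : ℕ) → List (Vec Bool n)
allSubsets zero    = [] ∷ []
allSubsets (suc n) = map (true ∷_) (allSubsets n) ++ map (false ∷_) (allSubsets n)

-- S is an ideal of ℤ_n: contains 0, closed under addition and under
-- multiplication by arbitrary ring elements (hence also under negation).
isIdeal : (n : ℕ) → Vec Bool n → Bool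
isIdeal n S =
  (S ∋ 0)
  ∧ all (λ x → all (λ y → (S ∋ x ∧ S ∋ y) ⇒ (S ∋ red n (x + y))) (elems n)) (elems n)
  ∧ all (λ r → all (λ x → (S ∋ x) ⇒ (S ∋ red n (r * x))) (elems n)) (elems n)

isNonzero : (n : ℕ) → Vec Bool n → Bool
isNonzero n S = any (λ x → (S ∋ x) ∧ not (x Data.Nat.≡ᵇ 0)) (elems n)

isProper : (n : ℕ) → Vec Bool n → Bool
isProper n S = any (λ x → not (S ∋ x)) (elems n)

_⊕_ : ∀ {n} → Vec Bool n → Vec Bool n → Vec Bool n
_⊕_ {n} I K = tabulate (λ i →
  any (λ a → any (λ b → I ∋ a ∧ K ∋ b ∧ (red n (a + b) Data.Nat.≡ᵇ toℕ i)) (elems n)) (elems n))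

_⊓_ : ∀ {n} → Vec Bool n → Vec Bool n → Vec Bool n
_⊓_ I J = Data.Vec.zipWith _∧_ I J

isEssential : (n : ℕ) → Vec Bool n → Bool
isEssential n I =
  all (λ J → (isIdeal n J ∧ isNonzero n J) ⇒ isNonzero n (I ⊓ J)) (allSubsets n)

eqV : ∀ {n} → Vec Bool n → Vec Bool n → Bool
eqV I K = ⌊ ≡-dec _≟B_ I K ⌋

vertices : (n : ℕ) → List (Vec Bool n)
vertices n = filter (λ S → Data.Bool.T? (isIdeal n S ∧ isNonzero n S ∧ isProper n S)) (allSubsets n)

adj : (n : ℕ) → Vec Bool n → Vec Bool n → Bool
adj n I K = not (eqV I K) ∧ isEssential n (I ⊕ K)

reach : (n : ℕ) → ℕ → Vec Bool n → Vec Bool n → Bool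
reach n zero    u v = eqV u v
reach n (suc k) u v = reach n k u v ∨ any (λ w → reach n k u w ∧ adj n w v) (vertices n)

-- least k < b with f k = true (returns b if none)
least : (ℕ → Bool) → ℕ → ℕ
least f zero    = zero
least f (suc b) = if f zero then zero else suc (least (λ k → f (suc k)) b)

-- graph distance (path lengths are < number of vertices in a connected graph)
dist : (n : ℕ) → Vec Bool n → Vec Bool n → ℕ
dist n u v = least (λ k → reach n k u v) (length (vertices n))

pairs : ∀ {A : Set} → List A → List (A × A)
pairs []       = []
pairs (x ∷ xs) = map (x ,_) xs ++ pairs xs

connected : (n : ℕ) → Bool
connected n = all (λ uv → reach n (length (vertices n)) (Data.Product.proj₁ uv) (Data.Product.proj₂ uv))
                  (pairs (vertices n))

wiener : (n : ℕ) → ℕ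
wiener n = sum (map (λ uv → dist n (Data.Product.proj₁ uv) (Data.Product.proj₂ uv)) (pairs (vertices n)))

-- The nonzero proper ideals of ℤₙ, n = pᵐqᵐ, are the ideals dℤₙ with d = pᵃqᵇ for the exponent
-- pairs (a, b) ∈ [0, m]² other than (0, 0) and (m, m). Every nonzero ideal contains one of the two minimal ideals,
-- generated by e₁ = pᵐ⁻¹qᵐ and e₂ = pᵐqᵐ⁻¹, and pᵃqᵇℤₙ contains e₁ iff a < m (e₂ iff b < m). Hence I + K is essential
-- iff it contains e₁ and e₂, so distinct vertices are adjacent unless both have a = m or both have b = m; such pairs
-- are at distance 2 through pqℤₙ. With N = (m + 1)² − 2 vertices and m vertices on each of the two lines,
-- 2W = N(N − 1) + 2m(m − 1), which is the stated polynomial.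
module Submission where

open import Defs
open import Data.Nat
  using (ℕ; zero; suc; pred; _+_; _*_; _^_; _∸_; _<_; _≤_; _≤?_; _%_; _/_; _≡ᵇ_; z≤n; s≤s; s≤s⁻¹;
         NonZero; >-nonZero; >-nonZero⁻¹; nonTrivial⇒≢1; nonTrivial⇒n>1)
open import Data.Nat.Properties
open import Data.Nat.DivMod using (m≡m%n+[m/n]*n; m%n<n; [m+kn]%n≡m%n; m<n⇒m%n≡m; n%n≡0; %-distribˡ-+; %-distribˡ-*)
open import Data.Nat.Divisibility
open import Data.Nat.Tactic.RingSolver using (solve-∀)
open import Data.Nat.Primality using (Prime; euclidsLemma; prime⇒irreducible; prime⇒nonZero; prime⇒nonTrivial)
open import Data.Nat.Coprimality as Coprimality using (Coprime; coprime-divisor)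
open import Data.Bool using (Bool; true; false; _∧_; _∨_; not; T)
open import Data.Bool.Properties using (T?; T-∧; T-∨; T-≡) renaming (_≟_ to _≟B_)
open import Function.Bundles using (Equivalence; mk⇔)
open import Data.Bool.ListAction using (all; any)
open import Data.List using (List; []; _∷_; map; _++_; filter; filterᵇ; length; upTo; cartesianProduct)
open import Data.List.Properties using (map-++; map-∘; map-cong-local; filter-all; length-map; length-++; length-upTo)
open import Data.Nat.ListAction using (sum)
open import Data.Nat.ListAction.Properties using (sum-++)
open import Data.List.Membership.Propositional using (_∈_; lose; find)
open import Data.List.Membership.Propositional.Properties
  using (∈-upTo⁺; ∈-upTo⁻; ∈-filter⁺; ∈-filter⁻; ∈-++⁺ˡ; ∈-++⁺ʳ; ∈-++⁻; ∈-map⁺; ∈-map⁻;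
         ∈-cartesianProduct⁺; ∈-cartesianProduct⁻)
open import Data.List.Relation.Unary.Any using (here; there; any?)
import Data.List.Relation.Unary.All as All
import Data.List.Relation.Unary.All.Properties as All
open import Data.List.Relation.Unary.All.Properties using (all⁺; all⁻)
open import Data.List.Membership.Propositional.Properties.WithK using (unique∧set⇒bag)
open import Data.List.Relation.Binary.BagAndSetEquality using (∼bag⇒↭)
open import Data.List.Relation.Binary.Permutation.Propositional.Properties using (↭-length)
open import Data.List.Relation.Unary.Any.Properties using (any⁺; any⁻)
open import Data.List.Relation.Unary.Unique.Propositional using (Unique)
import Data.List.Relation.Unary.Unique.Propositional.Properties as Unique
import Data.List.Relation.Unary.AllPairs as AllPairs
open import Data.Fin using (toℕ)
open import Data.Vec using (Vec; []; _∷_; tabulate)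
open import Data.Vec.Properties using (≡-dec; ∷-injectiveʳ)
open import Data.Product using (_×_; _,_; proj₁; proj₂; ∃-syntax)
open import Data.Product.Properties using () renaming (≡-dec to ×-≡-dec)
open import Relation.Binary.Definitions using (DecidableEquality)
open import Relation.Unary using (Decidable)
open import Data.Empty using (⊥; ⊥-elim)
open import Data.Sum using (_⊎_; inj₁; inj₂; [_,_]′)
open import Function using (_∘_; id)
open import Data.Nat.Induction using (<-rec)
open import Relation.Nullary using (¬_; yes; no; _×-dec_; ¬?)
open import Relation.Nullary.Decidable using (⌊_⌋; toWitness; fromWitness)
open import Relation.Binary.PropositionalEquality

T-⇒⁻ : ∀ {a b} → T (a ⇒ b) → T a → T b
T-⇒⁻ {true} t _ = t

T-⇒⁺ : ∀ {a b} → (T a → T b) → T (a ⇒ b)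
T-⇒⁺ {true}  f = f _
T-⇒⁺ {false} f = _

T-∧⁻ : ∀ {a b} → T (a ∧ b) → T a × T b
T-∧⁻ = Equivalence.to T-∧

T-∧⁺ : ∀ {a b} → T a → T b → T (a ∧ b)
T-∧⁺ ta tb = Equivalence.from T-∧ (ta , tb)

T-not⁺ : ∀ {b} → ¬ T b → T (not b)
T-not⁺ {false} _  = _
T-not⁺ {true}  ¬b = ¬b _

T-not⁻ : ∀ {b} → T (not b) → ¬ T b
T-not⁻ {false} _ ()

T-∨⁺ˡ : ∀ {a b} → T a → T (a ∨ b)
T-∨⁺ˡ {true} _ = _

T-∨⁺ʳ : ∀ {a b} → T b → T (a ∨ b)
T-∨⁺ʳ {true}  _  = _
T-∨⁺ʳ {false} tb = tb

T-∨⁻ : ∀ {a b} → T (a ∨ b) → T a ⊎ T b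
T-∨⁻ = Equivalence.to T-∨

T-injective : ∀ {a b} → (T a → T b) → (T b → T a) → a ≡ b
T-injective {false} {false} _ _ = refl
T-injective {false} {true}  _ g = ⊥-elim (g _)
T-injective {true}  {false} f _ = ⊥-elim (f _)
T-injective {true}  {true}  _ _ = refl

T-∨-stable : ∀ {a b} → (¬ T a → ¬ T b → ⊥) → T (a ∨ b)
T-∨-stable {true}          _ = _
T-∨-stable {false} {true}  _ = _
T-∨-stable {false} {false} h = h id id

module _ {A : Set} (f : A → Bool) where

  T-all⁻ : ∀ {xs x} → T (all f xs) → x ∈ xs → T (f x)
  T-all⁻ {xs} t = All.lookup (all⁺ f xs t)

  T-all⁺ : ∀ xs → (∀ {x} → x ∈ xs → T (f x)) → T (all f xs)
  T-all⁺ xs h = all⁻ f (All.tabulate h)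

  T-any⁺ : ∀ {xs x} → x ∈ xs → T (f x) → T (any f xs)
  T-any⁺ x∈xs fx = any⁺ f (lose x∈xs fx)

  T-any⁻ : ∀ {xs} → T (any f xs) → ∃[ x ] x ∈ xs × T (f x)
  T-any⁻ {xs} t = find (any⁻ f xs t)

module _ {n : ℕ} (f : ℕ → Bool) where

  T-all-elems⁻ : T (all f (elems n)) → ∀ {x} → x < n → T (f x)
  T-all-elems⁻ t = T-all⁻ f t ∘ ∈-upTo⁺

  T-all-elems⁺ : (∀ {x} → x < n → T (f x)) → T (all f (elems n))
  T-all-elems⁺ h = T-all⁺ f (elems n) (h ∘ ∈-upTo⁻)

  T-any-elems⁺ : ∀ {x} → x < n → T (f x) → T (any f (elems n))
  T-any-elems⁺ = T-any⁺ f ∘ ∈-upTo⁺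

  T-any-elems⁻ : T (any f (elems n)) → ∃[ x ] x < n × T (f x)
  T-any-elems⁻ t with x , x∈ , fx ← T-any⁻ f t = x , ∈-upTo⁻ x∈ , fx

∋-tabulate : ∀ {n} (f : ℕ → Bool) {x} → x < n → tabulate {n = n} (f ∘ toℕ) ∋ x ≡ f x
∋-tabulate {suc n} f {zero}  _         = refl
∋-tabulate {suc n} f {suc x} (s≤s x<n) = ∋-tabulate (f ∘ suc) x<n

∋-ext : ∀ {n} (S U : Vec Bool n) → (∀ {x} → x < n → S ∋ x ≡ U ∋ x) → S ≡ U
∋-ext []      []      _ = refl
∋-ext (a ∷ S) (b ∷ U) h = cong₂ _∷_ (h (s≤s z≤n)) (∋-ext S U (h ∘ s≤s))

∋-⊓ : ∀ {n} (S U : Vec Bool n) x → (S ⊓ U) ∋ x ≡ S ∋ x ∧ U ∋ x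
∋-⊓ []      []      _       = refl
∋-⊓ (a ∷ S) (b ∷ U) zero    = refl
∋-⊓ (a ∷ S) (b ∷ U) (suc x) = ∋-⊓ S U x

∈-allSubsets : ∀ n (S : Vec Bool n) → S ∈ allSubsets n
∈-allSubsets zero    []          = here refl
∈-allSubsets (suc n) (true ∷ S)  = ∈-++⁺ˡ (∈-map⁺ (true ∷_) (∈-allSubsets n S))
∈-allSubsets (suc n) (false ∷ S) = ∈-++⁺ʳ (map (true ∷_) (allSubsets n)) (∈-map⁺ (false ∷_) (∈-allSubsets n S))

allSubsets-Unique : ∀ n → Unique (allSubsets n)
allSubsets-Unique zero    = All.[] AllPairs.∷ AllPairs.[]
allSubsets-Unique (suc n) =
  Unique.++⁺ (Unique.map⁺ ∷-injectiveʳ (allSubsets-Unique n)) (Unique.map⁺ ∷-injectiveʳ (allSubsets-Unique n))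
             disjoint
  where
  disjoint : ∀ {S} → ¬ (S ∈ map (true ∷_) (allSubsets n) × S ∈ map (false ∷_) (allSubsets n))
  disjoint (S∈₁ , S∈₂) with _ , _ , refl ← ∈-map⁻ (true ∷_) S∈₁ | _ , _ , () ← ∈-map⁻ (false ∷_) S∈₂

eqV-sound : ∀ {n} {u v : Vec Bool n} → T (eqV u v) → u ≡ v
eqV-sound = toWitness

eqV-refl : ∀ {n} (u : Vec Bool n) → T (eqV u u)
eqV-refl u = fromWitness refl

eqV-false : ∀ {n} {u v : Vec Bool n} → u ≢ v → eqV u v ≡ false
eqV-false {u = u} {v} u≢v with ≡-dec _≟B_ u v
... | yes u≡v = ⊥-elim (u≢v u≡v)
... | no _    = refl

∣∧<⇒≡0 : ∀ {d r} → d ∣ r → r < d → r ≡ 0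
∣∧<⇒≡0 {r = zero}  _   _   = refl
∣∧<⇒≡0 {r = suc _} d∣r r<d = ⊥-elim (>⇒∤ r<d d∣r)

^-∣-^ : ∀ p {i j} → i ≤ j → p ^ i ∣ p ^ j
^-∣-^ p {i} {j} i≤j = subst (λ k → p ^ i ∣ p ^ k) (m+[n∸m]≡n i≤j)
  (subst (p ^ i ∣_) (sym (^-distribˡ-+-* p i (j ∸ i))) (m∣m*n (p ^ (j ∸ i))))

∣-coprime-product⇒≡0 : ∀ {s t z} → Coprime s t → s ∣ z → t ∣ z → z < s * t → z ≡ 0
∣-coprime-product⇒≡0 {z = zero}  _    _   _   _    = refl
∣-coprime-product⇒≡0 {s} {t} {suc z} s⊥t s∣z t∣z z<st = ⊥-elim (<⇒≱ z<st (∣⇒≤ st∣z))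
  where
  st∣z : s * t ∣ suc z
  st∣z = let divides k eq = s∣z in
    subst (s * t ∣_) (trans (*-comm s k) (sym eq))
      (*-monoʳ-∣ s (coprime-divisor (Coprimality.sym s⊥t) (subst (t ∣_) (trans eq (*-comm k s)) t∣z)))

∣p^k*r⇒ : ∀ {p} → Prime p → ∀ k r {d} → d ∣ p ^ k * r → ∃[ a ] ∃[ e ] a ≤ k × e ∣ r × d ≡ p ^ a * e
∣p^k*r⇒ _ zero r {d} d∣r = 0 , d , z≤n , subst (d ∣_) (+-identityʳ r) d∣r , sym (*-identityˡ d)
∣p^k*r⇒ {p} pp (suc k) r {d} d∣p^[1+k]r with p ∣? d
... | yes (divides d′ refl) =
  let a , e , a≤k , e∣r , d′≡ = ∣p^k*r⇒ pp k r {d′} (*-cancelʳ-∣ p {{prime⇒nonZero pp}} d′p∣p^kr*p)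
  in suc a , e , s≤s a≤k , e∣r , trans (cong (_* p) d′≡) (regroup (p ^ a) e p)
  where
  d′p∣p^kr*p : d′ * p ∣ p ^ k * r * p
  d′p∣p^kr*p = subst (d′ * p ∣_) (trans (*-assoc p (p ^ k) r) (*-comm p (p ^ k * r))) d∣p^[1+k]r
  regroup : ∀ x y z → x * y * z ≡ z * x * y
  regroup = solve-∀
... | no p∤d =
  let a , e , a≤k , e∣r , d≡ = ∣p^k*r⇒ pp k r (coprime-divisor d⊥p (subst (d ∣_) (*-assoc p (p ^ k) r) d∣p^[1+k]r))
  in a , e , m≤n⇒m≤1+n a≤k , e∣r , d≡
  where
  d⊥p : Coprime d p
  d⊥p (i∣d , i∣p) with prime⇒irreducible pp i∣p
  ... | inj₁ i≡1 = i≡1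
  ... | inj₂ refl = ⊥-elim (p∤d i∣d)

prime∤^ : ∀ {p q} → Prime p → Prime q → p ≢ q → ∀ b → ¬ p ∣ q ^ b
prime∤^ pp _  _   zero    p∣1 = nonTrivial⇒≢1 {{prime⇒nonTrivial pp}} (∣1⇒≡1 p∣1)
prime∤^ {p} {q} pp pq p≢q (suc b) p∣q^[1+b] with euclidsLemma q (q ^ b) pp p∣q^[1+b]
... | inj₂ p∣q^b = prime∤^ pp pq p≢q b p∣q^b
... | inj₁ p∣q with prime⇒irreducible pq p∣q
...   | inj₁ p≡1 = nonTrivial⇒≢1 {{prime⇒nonTrivial pp}} p≡1
...   | inj₂ p≡q = p≢q p≡q

^*^-∣⇒≤ : ∀ {p q} → Prime p → Prime q → p ≢ q → ∀ {a b c d} → p ^ a * q ^ b ∣ p ^ c * q ^ d → a ≤ c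
^*^-∣⇒≤ {p} {q} pp pq p≢q {a} {b} {c} {d} p^aq^b∣p^cq^d with a ≤? c
... | yes a≤c = a≤c
... | no a≰c = ⊥-elim (prime∤^ pp pq p≢q d (*-cancelˡ-∣ (p ^ c) {{m^n≢0 p c {{prime⇒nonZero pp}}}} p^c*p∣p^c*q^d))
  where
  p^c*p∣p^c*q^d : p ^ c * p ∣ p ^ c * q ^ d
  p^c*p∣p^c*q^d = subst (_∣ p ^ c * q ^ d) (*-comm p (p ^ c))
    (∣-trans (∣-trans (^-∣-^ p (≰⇒> a≰c)) (m∣m*n (q ^ b))) p^aq^b∣p^cq^d)

module PrimePowers {p q : ℕ} (pp : Prime p) (pq : Prime q) (p≢q : p ≢ q) where

  instance
    p-nonZero : NonZero p
    p-nonZero = prime⇒nonZero pp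
    q-nonZero : NonZero q
    q-nonZero = prime⇒nonZero pq

  ^*^-nonZero : ∀ a b → NonZero (p ^ a * q ^ b)
  ^*^-nonZero a b = m*n≢0 (p ^ a) (q ^ b) {{m^n≢0 p a}} {{m^n≢0 q b}}

  ^*^-∣⇒≤×≤ : ∀ {a b c d} → p ^ a * q ^ b ∣ p ^ c * q ^ d → a ≤ c × b ≤ d
  ^*^-∣⇒≤×≤ {a} {b} {c} {d} p^aq^b∣p^cq^d = ^*^-∣⇒≤ pp pq p≢q {a} {b} {c} {d} p^aq^b∣p^cq^d ,
    ^*^-∣⇒≤ pq pp (p≢q ∘ sym) {b} {a} {d} {c}
      (subst₂ _∣_ (*-comm (p ^ a) (q ^ b)) (*-comm (p ^ c) (q ^ d)) p^aq^b∣p^cq^d)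

  ^*^-injective : ∀ {a b c d} → p ^ a * q ^ b ≡ p ^ c * q ^ d → a ≡ c × b ≡ d
  ^*^-injective eq =
    let a≤c , b≤d = ^*^-∣⇒≤×≤ (∣-reflexive eq)
        c≤a , d≤b = ^*^-∣⇒≤×≤ (∣-reflexive (sym eq))
    in ≤-antisym a≤c c≤a , ≤-antisym b≤d d≤b

  ^*^-∣-^*^ : ∀ {a b c d} → a ≤ c → b ≤ d → p ^ a * q ^ b ∣ p ^ c * q ^ d
  ^*^-∣-^*^ a≤c b≤d = *-pres-∣ (^-∣-^ p a≤c) (^-∣-^ q b≤d)

  ∣^*^⇒ : ∀ k l {d} → d ∣ p ^ k * q ^ l → ∃[ a ] ∃[ b ] a ≤ k × b ≤ l × d ≡ p ^ a * q ^ b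
  ∣^*^⇒ k l d∣ with ∣p^k*r⇒ pp k (q ^ l) d∣
  ... | a , e , a≤k , e∣q^l , refl with ∣p^k*r⇒ pq l 1 (subst (e ∣_) (sym (*-identityʳ (q ^ l))) e∣q^l)
  ... | b , f , b≤l , f∣1 , refl with ∣1⇒≡1 f∣1
  ... | refl = a , b , a≤k , b≤l , cong (p ^ a *_) (*-identityʳ (q ^ b))

  ^⊥^ : ∀ a b → Coprime (p ^ a) (q ^ b)
  ^⊥^ a b {i} (i∣p^a , i∣q^b) with ∣p^k*r⇒ pp a 1 (subst (i ∣_) (sym (*-identityʳ (p ^ a))) i∣p^a)
  ... | a′ , e , _ , e∣1 , refl with ∣1⇒≡1 e∣1 | a′
  ... | refl | zero    = refl
  ... | refl | suc a″ = ⊥-elim (prime∤^ pp pq p≢q b (∣-trans (∣m⇒∣m*n 1 (m∣m*n (p ^ a″))) i∣q^b))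

T-not-≡ᵇ0 : ∀ x → T (not (x ≡ᵇ 0)) → 0 < x
T-not-≡ᵇ0 (suc _) _ = s≤s z≤n

module _ {n : ℕ} {S : Vec Bool n} where

  isNonzero⁺ : ∀ {x} → x < n → 0 < x → T (S ∋ x) → T (isNonzero n S)
  isNonzero⁺ {suc x} x<n _ x∈S = T-any-elems⁺ (λ x → (S ∋ x) ∧ not (x ≡ᵇ 0)) x<n (T-∧⁺ x∈S _)

  isNonzero⁻ : T (isNonzero n S) → ∃[ x ] x < n × 0 < x × T (S ∋ x)
  isNonzero⁻ t =
    let x , x<n , x∈S∧x≢0 = T-any-elems⁻ (λ x → (S ∋ x) ∧ not (x ≡ᵇ 0)) t
        x∈S , x≢0 = T-∧⁻ x∈S∧x≢0
    in x , x<n , T-not-≡ᵇ0 x x≢0 , x∈S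

module _ {n : ℕ} {S : Vec Bool n} where

  AddClosed MulClosed : Set
  AddClosed = ∀ {x y} → x < n → y < n → T (S ∋ x) → T (S ∋ y) → T (S ∋ red n (x + y))
  MulClosed = ∀ {r x} → r < n → x < n → T (S ∋ x) → T (S ∋ red n (r * x))

  private
    addClosed mulClosed : Bool
    addClosed = all (λ x → all (λ y → (S ∋ x ∧ S ∋ y) ⇒ (S ∋ red n (x + y))) (elems n)) (elems n)
    mulClosed = all (λ r → all (λ x → (S ∋ x) ⇒ (S ∋ red n (r * x))) (elems n)) (elems n)

  isIdeal⁻ : T (isIdeal n S) → T (S ∋ 0) × AddClosed × MulClosed
  isIdeal⁻ S-ideal with 0∈S , rest ← T-∧⁻ {S ∋ 0} {addClosed ∧ mulClosed} S-ideal =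
    let add , mul = T-∧⁻ rest in
    0∈S ,
    (λ {x} {y} x<n y<n x∈S y∈S →
      T-⇒⁻ (T-all-elems⁻ (λ y → (S ∋ x ∧ S ∋ y) ⇒ (S ∋ red n (x + y)))
            (T-all-elems⁻ (λ x → all (λ y → (S ∋ x ∧ S ∋ y) ⇒ (S ∋ red n (x + y))) (elems n)) add x<n) y<n)
          (T-∧⁺ x∈S y∈S)) ,
    (λ {r} {x} r<n x<n x∈S →
      T-⇒⁻ (T-all-elems⁻ (λ x → (S ∋ x) ⇒ (S ∋ red n (r * x)))
            (T-all-elems⁻ (λ r → all (λ x → (S ∋ x) ⇒ (S ∋ red n (r * x))) (elems n)) mul r<n) x<n)
          x∈S)

  isIdeal⁺ : T (S ∋ 0) → AddClosed → MulClosed → T (isIdeal n S)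
  isIdeal⁺ 0∈S add mul = T-∧⁺ 0∈S (T-∧⁺
    (T-all-elems⁺ (λ x → all (λ y → (S ∋ x ∧ S ∋ y) ⇒ (S ∋ red n (x + y))) (elems n)) λ {x} x<n →
      T-all-elems⁺ (λ y → (S ∋ x ∧ S ∋ y) ⇒ (S ∋ red n (x + y))) λ y<n →
        T-⇒⁺ λ t → let x∈S , y∈S = T-∧⁻ t in add x<n y<n x∈S y∈S)
    (T-all-elems⁺ (λ r → all (λ x → (S ∋ x) ⇒ (S ∋ red n (r * x))) (elems n)) λ {r} r<n →
      T-all-elems⁺ (λ x → (S ∋ x) ⇒ (S ∋ red n (r * x))) λ x<n →
        T-⇒⁺ (mul r<n x<n)))

red≡% : ∀ n .{{_ : NonZero n}} x → red n x ≡ x % n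
red≡% (suc _) _ = refl

multiplesOf : (n d : ℕ) → Vec Bool n
multiplesOf n d = tabulate (λ i → ⌊ d ∣? toℕ i ⌋)

module _ {n d x : ℕ} (x<n : x < n) where

  multiplesOf-∋⁻ : T (multiplesOf n d ∋ x) → d ∣ x
  multiplesOf-∋⁻ t = toWitness (subst T (∋-tabulate (λ y → ⌊ d ∣? y ⌋) x<n) t)

  multiplesOf-∋⁺ : d ∣ x → T (multiplesOf n d ∋ x)
  multiplesOf-∋⁺ d∣x = subst T (sym (∋-tabulate (λ y → ⌊ d ∣? y ⌋) x<n)) (fromWitness d∣x)

module Ideal {n : ℕ} .{{_ : NonZero n}} {S : Vec Bool n} (S-ideal : T (isIdeal n S)) where

  Has : ℕ → Set
  Has x = T (S ∋ (x % n))

  ∋⇒Has : ∀ {x} → x < n → T (S ∋ x) → Has x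
  ∋⇒Has x<n = subst (T ∘ (S ∋_)) (sym (m<n⇒m%n≡m x<n))

  Has⇒∋ : ∀ {x} → x < n → Has x → T (S ∋ x)
  Has⇒∋ x<n = subst (T ∘ (S ∋_)) (m<n⇒m%n≡m x<n)

  private
    closure : T (S ∋ 0) × AddClosed {S = S} × MulClosed {S = S}
    closure = isIdeal⁻ {S = S} S-ideal

    +-closed : AddClosed {S = S}
    +-closed = proj₁ (proj₂ closure)

    *-closed : MulClosed {S = S}
    *-closed = proj₂ (proj₂ closure)

    %<n : ∀ x → x % n < n
    %<n x = m%n<n x n

  0∈ : T (S ∋ 0)
  0∈ = proj₁ closure

  Has-+ : ∀ {x y} → Has x → Has y → Has (x + y)
  Has-+ {x} {y} hx hy = subst (T ∘ (S ∋_)) (trans (red≡% n _) (sym (%-distribˡ-+ x y n)))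
    (+-closed (%<n x) (%<n y) hx hy)

  Has-* : ∀ r {x} → Has x → Has (r * x)
  Has-* r {x} hx = subst (T ∘ (S ∋_)) (trans (red≡% n _) (sym (%-distribˡ-* r x n)))
    (*-closed (%<n r) (%<n x) hx)

  Has-+*n : ∀ {x} k → Has (x + k * n) → Has x
  Has-+*n {x} k = subst (T ∘ (S ∋_)) ([m+kn]%n≡m%n x k n)

  -- Modulo n, y % x ≡ y + (y / x)(n − 1)x, a combination of y and a multiple of x.
  Has-% : ∀ {x y} .{{_ : NonZero x}} → Has x → Has y → Has (y % x)
  Has-% {x} {y} hx hy = Has-+*n (y / x * x) (subst Has combination (Has-+ hy (Has-* (y / x * pred n) hx)))
    where
    open ≡-Reasoning
    regroup : ∀ r k x n′ → r + k * x + k * n′ * x ≡ r + k * x * suc n′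
    regroup = solve-∀
    combination : y + y / x * pred n * x ≡ y % x + y / x * x * n
    combination = begin
      y + y / x * pred n * x                     ≡⟨ cong (_+ y / x * pred n * x) (m≡m%n+[m/n]*n y x) ⟩
      y % x + y / x * x + y / x * pred n * x     ≡⟨ regroup (y % x) (y / x) x (pred n) ⟩
      y % x + y / x * x * suc (pred n)           ≡⟨ cong (λ k → y % x + y / x * x * k) (suc-pred n) ⟩
      y % x + y / x * x * n                      ∎

  ∣-closed : ∀ {d y} → d < n → T (S ∋ d) → y < n → d ∣ y → T (S ∋ y)
  ∣-closed d<n d∈S y<n (divides k refl) = Has⇒∋ y<n (Has-* k (∋⇒Has d<n d∈S))

  IsGenerator : ℕ → Set
  IsGenerator d = 0 < d × d < n × T (S ∋ d) × (∀ {y} → y < n → T (S ∋ y) → d ∣ y)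

  -- Euclid's descent: an element x not dividing some y ∈ S is replaced by the smaller y % x ∈ S.
  generator : ∀ x → 0 < x → x < n → T (S ∋ x) → ∃[ d ] IsGenerator d
  generator = <-rec _ descend
    where
    descend : ∀ x → (∀ {r} → r < x → 0 < r → r < n → T (S ∋ r) → ∃[ d ] IsGenerator d) →
              0 < x → x < n → T (S ∋ x) → ∃[ d ] IsGenerator d
    descend x recurse 0<x x<n x∈S with any? (λ y → T? (S ∋ y) ×-dec ¬? (x ∣? y)) (elems n)
    ... | yes witness =
      let y , y∈ , y∈S , x∤y = find witness
          instance _ = >-nonZero 0<x
          r<x = m%n<n y x
      in recurse r<x (n≢0⇒n>0 (x∤y ∘ m%n≡0⇒n∣m y x))
           (<-trans r<x x<n)
           (Has⇒∋ (<-trans r<x x<n) (Has-% (∋⇒Has x<n x∈S) (∋⇒Has (∈-upTo⁻ y∈) y∈S)))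
    ... | no none = x , 0<x , x<n , x∈S , divides-all
      where
      divides-all : ∀ {y} → y < n → T (S ∋ y) → x ∣ y
      divides-all {y} y<n y∈S with x ∣? y
      ... | yes x∣y = x∣y
      ... | no x∤y  = ⊥-elim (none (lose (∈-upTo⁺ y<n) (y∈S , x∤y)))

  ≡multiplesOf : T (isNonzero n S) → ∃[ d ] d ∣ n × 0 < d × d < n × S ≡ multiplesOf n d
  ≡multiplesOf nonzero =
    let x , x<n , 0<x , x∈S = isNonzero⁻ {S = S} nonzero
        d , 0<d , d<n , d∈S , d∣S = generator x 0<x x<n x∈S
        instance _ = >-nonZero 0<d
        n%d<d = m%n<n n d
        n%d∈S = Has⇒∋ (<-trans n%d<d d<n)
                  (Has-% (∋⇒Has d<n d∈S) (subst (T ∘ (S ∋_)) (sym (n%n≡0 n)) 0∈))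
        d∣n = m%n≡0⇒n∣m n d (∣∧<⇒≡0 (d∣S (<-trans n%d<d d<n) n%d∈S) n%d<d)
    in d , d∣n , 0<d , d<n , ∋-ext S (multiplesOf n d) λ {y} y<n →
         T-injective (multiplesOf-∋⁺ y<n ∘ d∣S y<n) (∣-closed d<n d∈S y<n ∘ multiplesOf-∋⁻ y<n)

multiplesOf-isIdeal : ∀ n .{{_ : NonZero n}} {d} → d ∣ n → T (isIdeal n (multiplesOf n d))
multiplesOf-isIdeal n {d} d∣n = isIdeal⁺ {S = multiplesOf n d} (multiplesOf-∋⁺ (>-nonZero⁻¹ n) (d ∣0))
  (λ x<n y<n x∈ y∈ → reduced (∣m∣n⇒∣m+n (multiplesOf-∋⁻ x<n x∈) (multiplesOf-∋⁻ y<n y∈)))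
  (λ {r} _ x<n x∈ → reduced (∣n⇒∣m*n r (multiplesOf-∋⁻ x<n x∈)))
  where
  reduced : ∀ {x} → d ∣ x → T (multiplesOf n d ∋ red n x)
  reduced {x} d∣x = subst (T ∘ (multiplesOf n d ∋_)) (sym (red≡% n x))
    (multiplesOf-∋⁺ (m%n<n x n) (%-presˡ-∣ d∣x d∣n))

multiplesOf-isNonzero : ∀ {n d} → 0 < d → d < n → T (isNonzero n (multiplesOf n d))
multiplesOf-isNonzero {n} {d} 0<d d<n = isNonzero⁺ {S = multiplesOf n d} d<n 0<d (multiplesOf-∋⁺ d<n ∣-refl)

multiplesOf-isProper : ∀ {n d} → 1 < n → d ≢ 1 → T (isProper n (multiplesOf n d))
multiplesOf-isProper {n} {d} 1<n d≢1 =
  T-any-elems⁺ (λ x → not (multiplesOf n d ∋ x)) 1<n (T-not⁺ (d≢1 ∘ ∣1⇒≡1 ∘ multiplesOf-∋⁻ 1<n))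

multiplesOf-1-improper : ∀ {n} → ¬ T (isProper n (multiplesOf n 1))
multiplesOf-1-improper {n} t with x , x<n , x∉ ← T-any-elems⁻ {n} (λ x → not (multiplesOf n 1 ∋ x)) t =
  T-not⁻ x∉ (multiplesOf-∋⁺ x<n (1∣ _))

multiplesOf-injective : ∀ {n d e} → d < n → e < n → multiplesOf n d ≡ multiplesOf n e → d ≡ e
multiplesOf-injective d<n e<n eq = ∣-antisym
  (multiplesOf-∋⁻ e<n (subst (λ S → T (S ∋ _)) (sym eq) (multiplesOf-∋⁺ e<n ∣-refl)))
  (multiplesOf-∋⁻ d<n (subst (λ S → T (S ∋ _)) eq (multiplesOf-∋⁺ d<n ∣-refl)))

module _ {n : ℕ} .{{_ : NonZero n}} (I K : Vec Bool n) where

  private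
    sumHas : ℕ → Bool
    sumHas z = any (λ a → any (λ b → I ∋ a ∧ K ∋ b ∧ (red n (a + b) ≡ᵇ z)) (elems n)) (elems n)

    ∋-⊕ : ∀ {z} → z < n → (I ⊕ K) ∋ z ≡ sumHas z
    ∋-⊕ = ∋-tabulate sumHas

    ⊕-intro : ∀ {a b z} → a < n → b < n → T (I ∋ a) → T (K ∋ b) → red n (a + b) ≡ z → z < n → T ((I ⊕ K) ∋ z)
    ⊕-intro {a} {b} {z} a<n b<n a∈I b∈K sum≡z z<n = subst T (sym (∋-⊕ z<n))
      (T-any-elems⁺ (λ a → any (λ b → I ∋ a ∧ K ∋ b ∧ (red n (a + b) ≡ᵇ z)) (elems n)) a<n
        (T-any-elems⁺ (λ b → I ∋ a ∧ K ∋ b ∧ (red n (a + b) ≡ᵇ z)) b<n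
          (T-∧⁺ a∈I (T-∧⁺ b∈K (≡⇒≡ᵇ _ _ sum≡z)))))

    reduced : ∀ {z} → z < n → red n z ≡ z
    reduced {z} z<n = trans (red≡% n z) (m<n⇒m%n≡m z<n)

  ⊆-⊕ˡ : ∀ {z} → z < n → T (I ∋ z) → T (K ∋ 0) → T ((I ⊕ K) ∋ z)
  ⊆-⊕ˡ {z} z<n z∈I 0∈K = ⊕-intro z<n (>-nonZero⁻¹ n) z∈I 0∈K (trans (cong (red n) (+-identityʳ z)) (reduced z<n)) z<n

  ⊆-⊕ʳ : ∀ {z} → z < n → T (I ∋ 0) → T (K ∋ z) → T ((I ⊕ K) ∋ z)
  ⊆-⊕ʳ z<n 0∈I z∈K = ⊕-intro (>-nonZero⁻¹ n) z<n 0∈I z∈K (reduced z<n) z<n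

  ⊕-∣ : ∀ {t} → t ∣ n → (∀ {x} → x < n → T (I ∋ x) → t ∣ x) → (∀ {x} → x < n → T (K ∋ x) → t ∣ x) →
        ∀ {z} → z < n → T ((I ⊕ K) ∋ z) → t ∣ z
  ⊕-∣ {t} t∣n t∣I t∣K {z} z<n z∈I⊕K =
    let a , a<n , t′ = T-any-elems⁻ (λ a → any (λ b → I ∋ a ∧ K ∋ b ∧ (red n (a + b) ≡ᵇ z)) (elems n))
                         (subst T (∋-⊕ z<n) z∈I⊕K)
        b , b<n , t″ = T-any-elems⁻ (λ b → I ∋ a ∧ K ∋ b ∧ (red n (a + b) ≡ᵇ z)) t′
        a∈I , rest = T-∧⁻ t″
        b∈K , sum≡z = T-∧⁻ rest
    in subst (t ∣_) (trans (sym (red≡% n (a + b))) (≡ᵇ⇒≡ _ _ sum≡z))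
         (%-presˡ-∣ (∣m∣n⇒∣m+n (t∣I a<n a∈I) (t∣K b<n b∈K)) t∣n)

⊆-⊕-∨ : ∀ {n} .{{_ : NonZero n}} (I K : Vec Bool n) {z} → z < n → T (I ∋ 0) → T (K ∋ 0) → T (I ∋ z ∨ K ∋ z) →
        T ((I ⊕ K) ∋ z)
⊆-⊕-∨ I K z<n 0∈I 0∈K t = [ (λ z∈I → ⊆-⊕ˡ I K z<n z∈I 0∈K) , (λ z∈K → ⊆-⊕ʳ I K z<n 0∈I z∈K) ]′ (T-∨⁻ {I ∋ _} t)

module _ {n : ℕ} {I : Vec Bool n} where

  private
    meetsIdeals : Vec Bool n → Bool
    meetsIdeals J = (isIdeal n J ∧ isNonzero n J) ⇒ isNonzero n (I ⊓ J)

  isEssential⁺ : (∀ {J} → T (isIdeal n J) → T (isNonzero n J) → ∃[ z ] z < n × 0 < z × T (I ∋ z) × T (J ∋ z)) →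
                      T (isEssential n I)
  isEssential⁺ meets = T-all⁺ meetsIdeals (allSubsets n) λ {J} _ → T-⇒⁺ {isIdeal n J ∧ isNonzero n J} λ t →
    let J-ideal , J-nonzero = T-∧⁻ t
        z , z<n , 0<z , z∈I , z∈J = meets {J} J-ideal J-nonzero
    in isNonzero⁺ {S = I ⊓ J} z<n 0<z (subst T (sym (∋-⊓ I J z)) (T-∧⁺ z∈I z∈J))

  ¬isEssential : ∀ {J} → T (isIdeal n J) → T (isNonzero n J) → (∀ {z} → z < n → T (I ∋ z) → T (J ∋ z) → z ≡ 0) →
                 ¬ T (isEssential n I)
  ¬isEssential {J} J-ideal J-nonzero disjoint essential =
    let meets = T-all⁻ meetsIdeals essential (∈-allSubsets n J)
        z , z<n , 0<z , z∈I⊓J = isNonzero⁻ {S = I ⊓ J} (T-⇒⁻ {isIdeal n J ∧ isNonzero n J} meets (T-∧⁺ J-ideal J-nonzero))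
        z∈I , z∈J = T-∧⁻ (subst T (∋-⊓ I J z) z∈I⊓J)
    in <⇒≢ 0<z (sym (disjoint z<n z∈I z∈J))

-- s divides every element of I ⊕ K, so I ⊕ K meets the nonzero ideal tℤₙ only in 0.
⊕-¬isEssential : ∀ {n s t} .{{_ : NonZero n}} .{{_ : NonZero t}} → Coprime s t → s * t ≡ n → 1 < s →
                 (I K : Vec Bool n) → (∀ {x} → x < n → T (I ∋ x) → s ∣ x) → (∀ {x} → x < n → T (K ∋ x) → s ∣ x) →
                 ¬ T (isEssential n (I ⊕ K))
⊕-¬isEssential {n} {s} {t} s⊥t st≡n 1<s I K s∣I s∣K =
  ¬isEssential {I = I ⊕ K} {multiplesOf n t}
    (multiplesOf-isIdeal n t∣n) (multiplesOf-isNonzero (>-nonZero⁻¹ t) t<n) disjoint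
  where
  t∣n : t ∣ n
  t∣n = subst (t ∣_) st≡n (n∣m*n s)
  t<n : t < n
  t<n = subst (t <_) (trans (*-comm t s) st≡n) (m<m*n t s 1<s)
  disjoint : ∀ {z} → z < n → T ((I ⊕ K) ∋ z) → T (multiplesOf n t ∋ z) → z ≡ 0
  disjoint z<n z∈I⊕K z∈tℤ = ∣-coprime-product⇒≡0 s⊥t
    (⊕-∣ I K (subst (s ∣_) st≡n (m∣m*n t)) s∣I s∣K z<n z∈I⊕K) (multiplesOf-∋⁻ z<n z∈tℤ) (subst (_ <_) (sym st≡n) z<n)

vertices-Unique : ∀ n → Unique (vertices n)
vertices-Unique n = Unique.filter⁺ (λ S → T? (isIdeal n S ∧ isNonzero n S ∧ isProper n S)) (allSubsets-Unique n)

module _ {n : ℕ} {S : Vec Bool n} where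

  ∈-vertices⁻ : S ∈ vertices n → T (isIdeal n S) × T (isNonzero n S) × T (isProper n S)
  ∈-vertices⁻ S∈V =
    let _ , t = ∈-filter⁻ (λ S → T? (isIdeal n S ∧ isNonzero n S ∧ isProper n S)) {xs = allSubsets n} S∈V
        S-ideal , rest = T-∧⁻ {isIdeal n S} t
    in S-ideal , T-∧⁻ rest

  ∈-vertices⁺ : T (isIdeal n S) → T (isNonzero n S) → T (isProper n S) → S ∈ vertices n
  ∈-vertices⁺ S-ideal S-nonzero S-proper =
    ∈-filter⁺ (λ S → T? (isIdeal n S ∧ isNonzero n S ∧ isProper n S)) {xs = allSubsets n}
      (∈-allSubsets n S) (T-∧⁺ S-ideal (T-∧⁺ S-nonzero S-proper))

least-≡ : ∀ (f : ℕ → Bool) {b k} → k < b → T (f k) → (∀ {j} → j < k → ¬ T (f j)) → least f b ≡ k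
least-≡ f {suc b} {zero} _ f0 _ with f 0
... | true = refl
least-≡ f {suc b} {suc k} (s≤s k<b) fk below with f 0 | below {0} (s≤s z≤n)
... | false | _   = cong suc (least-≡ (f ∘ suc) k<b fk (below ∘ s≤s))
... | true  | ¬f0 = ⊥-elim (¬f0 _)

module _ {n : ℕ} where

  private
    V : List (Vec Bool n)
    V = vertices n

  reach-+ : ∀ j {k u v} → T (reach n k u v) → T (reach n (j + k) u v)
  reach-+ zero    r = r
  reach-+ (suc j) r = T-∨⁺ˡ (reach-+ j r)

  reach-1 : ∀ {u v} → u ∈ V → reach n 1 u v ≡ eqV u v ∨ adj n u v
  reach-1 {u} {v} u∈V = cong (eqV u v ∨_) (T-injective
    (λ t → let w , _ , t′ = T-any⁻ (λ w → eqV u w ∧ adj n w v) {V} t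
               u≡w , w~v = T-∧⁻ t′
           in subst (λ w → T (adj n w v)) (sym (eqV-sound u≡w)) w~v)
    (λ u~v → T-any⁺ (λ w → eqV u w ∧ adj n w v) u∈V (T-∧⁺ (eqV-refl u) u~v)))

  reach-1-adj : ∀ {u v} → u ∈ V → T (adj n u v) → T (reach n 1 u v)
  reach-1-adj {u} {v} u∈V u~v = subst T (sym (reach-1 u∈V)) (T-∨⁺ʳ {eqV u v} u~v)

  reach-2 : ∀ {u w v} → u ∈ V → w ∈ V → T (adj n u w) → T (adj n w v) → T (reach n 2 u v)
  reach-2 {u} {w} {v} u∈V w∈V u~w w~v =
    T-∨⁺ʳ {reach n 1 u v} (T-any⁺ (λ w → reach n 1 u w ∧ adj n w v) w∈V (T-∧⁺ (reach-1-adj u∈V u~w) w~v))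

  module _ {u v : Vec Bool n} (u∈V : u ∈ V) (u≢v : u ≢ v) where

    private
      ¬reach-0 : ¬ T (reach n 0 u v)
      ¬reach-0 = u≢v ∘ eqV-sound

      ¬reach-1 : ¬ T (adj n u v) → ¬ T (reach n 1 u v)
      ¬reach-1 u≁v t = u≁v (subst T (trans (reach-1 u∈V) (cong (_∨ adj n u v) (eqV-false u≢v))) t)

    dist≡1 : 1 < length V → T (adj n u v) → dist n u v ≡ 1
    dist≡1 1<|V| u~v = least-≡ (λ k → reach n k u v) 1<|V| (reach-1-adj u∈V u~v) λ { (s≤s z≤n) → ¬reach-0 }

    dist≡2 : ∀ {w} → 2 < length V → w ∈ V → ¬ T (adj n u v) → T (adj n u w) → T (adj n w v) → dist n u v ≡ 2
    dist≡2 2<|V| w∈V u≁v u~w w~v = least-≡ (λ k → reach n k u v) 2<|V| (reach-2 u∈V w∈V u~w w~v)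
      λ { (s≤s z≤n) → ¬reach-0 ; (s≤s (s≤s z≤n)) → ¬reach-1 u≁v }

indicator : Bool → ℕ
indicator true  = 1
indicator false = 0

indicator-nor-0 : ∀ {a b} → T (a ∨ b) → indicator (not a ∧ not b) ≡ 0
indicator-nor-0 {true}          _ = refl
indicator-nor-0 {false} {true}  _ = refl

indicator-nor-1 : ∀ {a b} → ¬ T (a ∨ b) → indicator (not a ∧ not b) ≡ 1
indicator-nor-1 {true}          ¬t = ⊥-elim (¬t _)
indicator-nor-1 {false} {true}  ¬t = ⊥-elim (¬t _)
indicator-nor-1 {false} {false} _  = refl

-- Adjacency of distinct vertices is decided by two elements e₁ and e₂, and the vertex w contains both;
-- then non-adjacent vertices are at distance 2, through w.
module TwoWitnesses {n : ℕ} (e₁ e₂ : ℕ)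
  (adj≡ : ∀ {u v} → u ∈ vertices n → v ∈ vertices n → u ≢ v → adj n u v ≡ (u ∋ e₁ ∨ v ∋ e₁) ∧ (u ∋ e₂ ∨ v ∋ e₂))
  (covers : ∀ {u} → u ∈ vertices n → T (u ∋ e₁ ∨ u ∋ e₂))
  {w : Vec Bool n} (w∈V : w ∈ vertices n) (w∋e₁ : T (w ∋ e₁)) (w∋e₂ : T (w ∋ e₂))
  where

  private
    V : List (Vec Bool n)
    V = vertices n

    adj-intro : ∀ {u v} → u ∈ V → v ∈ V → u ≢ v → T (u ∋ e₁ ∨ v ∋ e₁) → T (u ∋ e₂ ∨ v ∋ e₂) → T (adj n u v)
    adj-intro u∈V v∈V u≢v t₁ t₂ = subst T (sym (adj≡ u∈V v∈V u≢v)) (T-∧⁺ t₁ t₂)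

    adj-elim : ∀ {u v} → u ∈ V → v ∈ V → u ≢ v → T (adj n u v) → T (u ∋ e₁ ∨ v ∋ e₁) × T (u ∋ e₂ ∨ v ∋ e₂)
    adj-elim u∈V v∈V u≢v u~v = T-∧⁻ (subst T (adj≡ u∈V v∈V u≢v) u~v)

    ~w : ∀ {u} → u ∈ V → u ≢ w → T (adj n u w)
    ~w {u} u∈V u≢w = adj-intro u∈V w∈V u≢w (T-∨⁺ʳ {u ∋ e₁} w∋e₁) (T-∨⁺ʳ {u ∋ e₂} w∋e₂)

    w~ : ∀ {v} → v ∈ V → w ≢ v → T (adj n w v)
    w~ v∈V w≢v = adj-intro w∈V v∈V w≢v (T-∨⁺ˡ w∋e₁) (T-∨⁺ˡ w∋e₂)

    ≢w : ∀ {u e} → T (w ∋ e) → ¬ T (u ∋ e) → u ≢ w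
    ≢w w∋e u∌e refl = u∌e w∋e

    ∌e⇒∋e : ∀ {u} → u ∈ V → ¬ T (u ∋ e₁) → T (u ∋ e₂)
    ∌e⇒∋e {u} u∈V u∌e₁ = [ ⊥-elim ∘ u∌e₁ , id ]′ (T-∨⁻ {u ∋ e₁} (covers u∈V))

    via-w : ∀ {u v e} → u ∈ V → v ∈ V → T (w ∋ e) → ¬ T (u ∋ e ∨ v ∋ e) → T (adj n u w) × T (adj n w v)
    via-w {u} u∈V v∈V w∋e ¬t = ~w u∈V (≢w w∋e (¬t ∘ T-∨⁺ˡ)) , w~ v∈V (≢w w∋e (¬t ∘ T-∨⁺ʳ {u ∋ _}) ∘ sym)

  module _ {u v : Vec Bool n} (u∈V : u ∈ V) (v∈V : v ∈ V) (u≢v : u ≢ v) where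

    reach-2-all : T (reach n 2 u v)
    reach-2-all with T? (u ∋ e₁ ∨ v ∋ e₁) | T? (u ∋ e₂ ∨ v ∋ e₂)
    ... | yes t₁ | yes t₂ = reach-+ {n} 1 {1} {u} {v} (reach-1-adj u∈V (adj-intro u∈V v∈V u≢v t₁ t₂))
    ... | no ¬t₁ | _      = let u~w , w~v = via-w u∈V v∈V w∋e₁ ¬t₁ in reach-2 u∈V w∈V u~w w~v
    ... | yes _  | no ¬t₂ = let u~w , w~v = via-w u∈V v∈V w∋e₂ ¬t₂ in reach-2 u∈V w∈V u~w w~v

    dist≡ : 2 < length V →
            dist n u v ≡ 1 + indicator (not (u ∋ e₁) ∧ not (v ∋ e₁)) + indicator (not (u ∋ e₂) ∧ not (v ∋ e₂))
    dist≡ 2<|V| with T? (u ∋ e₁ ∨ v ∋ e₁) | T? (u ∋ e₂ ∨ v ∋ e₂)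
    ... | yes t₁ | yes t₂ rewrite indicator-nor-0 {u ∋ e₁} t₁ | indicator-nor-0 {u ∋ e₂} t₂ =
      dist≡1 u∈V u≢v (<-trans (s≤s (s≤s z≤n)) 2<|V|) (adj-intro u∈V v∈V u≢v t₁ t₂)
    ... | no ¬t₁ | _      rewrite indicator-nor-1 {u ∋ e₁} ¬t₁
                              | indicator-nor-0 {u ∋ e₂} {v ∋ e₂} (T-∨⁺ˡ (∌e⇒∋e u∈V (¬t₁ ∘ T-∨⁺ˡ))) =
      let u~w , w~v = via-w u∈V v∈V w∋e₁ ¬t₁ in
      dist≡2 u∈V u≢v 2<|V| w∈V (¬t₁ ∘ proj₁ ∘ adj-elim u∈V v∈V u≢v) u~w w~v
    ... | yes t₁ | no ¬t₂ rewrite indicator-nor-0 {u ∋ e₁} t₁ | indicator-nor-1 {u ∋ e₂} ¬t₂ =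
      let u~w , w~v = via-w u∈V v∈V w∋e₂ ¬t₂ in
      dist≡2 u∈V u≢v 2<|V| w∈V (¬t₂ ∘ proj₂ ∘ adj-elim u∈V v∈V u≢v) u~w w~v

module _ {A : Set} where

  Unique-set⇒length≡ : ∀ {xs ys : List A} → Unique xs → Unique ys →
                       (∀ {x} → x ∈ xs → x ∈ ys) → (∀ {x} → x ∈ ys → x ∈ xs) → length xs ≡ length ys
  Unique-set⇒length≡ xs! ys! xs⊆ys ys⊆xs = ↭-length (∼bag⇒↭ (unique∧set⇒bag xs! ys! (mk⇔ xs⊆ys ys⊆xs)))

  Unique-map⁺ : ∀ {B : Set} (f : A → B) {xs} → Unique xs → (∀ {x y} → x ∈ xs → y ∈ xs → f x ≡ f y → x ≡ y) →
                Unique (map f xs)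
  Unique-map⁺ f {[]}     _               _   = AllPairs.[]
  Unique-map⁺ f {x ∷ xs} (x∉xs AllPairs.∷ xs!) inj =
    All.map⁺ (All.tabulate λ y∈xs fx≡fy → All.lookup x∉xs y∈xs (inj (here refl) (there y∈xs) fx≡fy))
    AllPairs.∷ Unique-map⁺ f xs! (λ x∈ y∈ → inj (there x∈) (there y∈))

  pairs-∈ : ∀ {L : List A} → Unique L → ∀ {u v} → (u , v) ∈ pairs L → u ∈ L × v ∈ L × u ≢ v
  pairs-∈ {x ∷ xs} (x∉xs AllPairs.∷ xs!) uv∈ with ∈-++⁻ (map (x ,_) xs) uv∈
  ... | inj₁ uv∈xxs with _ , y∈xs , refl ← ∈-map⁻ (x ,_) uv∈xxs = here refl , there y∈xs , All.lookup x∉xs y∈xs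
  ... | inj₂ uv∈pairs = let u∈ , v∈ , u≢v = pairs-∈ xs! uv∈pairs in there u∈ , there v∈ , u≢v

length-cartesianProduct : ∀ {A B : Set} (xs : List A) (ys : List B) →
                          length (cartesianProduct xs ys) ≡ length xs * length ys
length-cartesianProduct []       ys = refl
length-cartesianProduct (x ∷ xs) ys =
  trans (length-++ (map (x ,_) ys)) (cong₂ _+_ (length-map (x ,_) ys) (length-cartesianProduct xs ys))

sum-map-+ : ∀ {A : Set} (f g : A → ℕ) L → sum (map (λ x → f x + g x) L) ≡ sum (map f L) + sum (map g L)
sum-map-+ f g []      = refl
sum-map-+ f g (x ∷ L) =
  trans (cong (f x + g x +_) (sum-map-+ f g L)) (+-comm-middle (f x) (g x) (sum (map f L)) (sum (map g L)))
  where
  +-comm-middle : ∀ a b c d → a + b + (c + d) ≡ a + c + (b + d)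
  +-comm-middle = solve-∀

module _ {A : Set} (P : A → Bool) where

  count : List A → ℕ
  count L = length (filterᵇ P L)

  pairCount : List A → ℕ
  pairCount L = sum (map (λ uv → indicator (P (proj₁ uv) ∧ P (proj₂ uv))) (pairs L))

  private
    sum-indicator : ∀ L → sum (map (indicator ∘ P) L) ≡ count L
    sum-indicator []      = refl
    sum-indicator (x ∷ L) with P x
    ... | true  = cong suc (sum-indicator L)
    ... | false = sum-indicator L

    pairCount-∷ : ∀ x L → pairCount (x ∷ L) ≡ sum (map (λ y → indicator (P x ∧ P y)) L) + pairCount L
    pairCount-∷ x L = begin
      sum (map F (map (x ,_) L ++ pairs L))          ≡⟨ cong sum (map-++ F (map (x ,_) L) (pairs L)) ⟩
      sum (map F (map (x ,_) L) ++ map F (pairs L))  ≡⟨ sum-++ (map F (map (x ,_) L)) (map F (pairs L)) ⟩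
      sum (map F (map (x ,_) L)) + pairCount L       ≡⟨ cong (λ ys → sum ys + pairCount L) (sym (map-∘ L)) ⟩
      sum (map (λ y → indicator (P x ∧ P y)) L) + pairCount L ∎
      where
      open ≡-Reasoning
      F : A × A → ℕ
      F uv = indicator (P (proj₁ uv) ∧ P (proj₂ uv))

    sum-zeros : ∀ L → sum (map (λ (y : A) → 0) L) ≡ 0
    sum-zeros []      = refl
    sum-zeros (_ ∷ L) = sum-zeros L

    square-step : ∀ c s → 2 * s + c ≡ c * c → 2 * (c + s) + suc c ≡ suc c * suc c
    square-step c s eq = begin
      2 * (c + s) + suc c        ≡⟨ regroup c s ⟩
      (2 * s + c) + (2 * c + 1)  ≡⟨ cong (_+ (2 * c + 1)) eq ⟩
      c * c + (2 * c + 1)        ≡⟨ expand c ⟩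
      suc c * suc c              ∎
      where
      open ≡-Reasoning
      regroup : ∀ c s → 2 * (c + s) + suc c ≡ (2 * s + c) + (2 * c + 1)
      regroup = solve-∀
      expand : ∀ c → c * c + (2 * c + 1) ≡ suc c * suc c
      expand = solve-∀

  -- pairCount P L = (c choose 2) for c = count P L, in subtraction-free form.
  2*pairCount+count≡count² : ∀ L → 2 * pairCount L + count L ≡ count L * count L
  2*pairCount+count≡count² []      = refl
  2*pairCount+count≡count² (x ∷ L) rewrite pairCount-∷ x L with P x
  ... | true  rewrite sum-indicator L = square-step (count L) (pairCount L) (2*pairCount+count≡count² L)
  ... | false rewrite sum-zeros L     = 2*pairCount+count≡count² L

-- The facts about ℤₙ, n = Pᵐ Qᵐ, that concern one of the two primes; used with (P, Q) = (p, q) and (q, p).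
module Side {P Q m n : ℕ} (pP : Prime P) (pQ : Prime Q) (P≢Q : P ≢ Q) (PQ≡n : P ^ m * Q ^ m ≡ n) (0<m : 0 < m) where

  open PrimePowers pP pQ P≢Q

  instance
    n-nonZero : NonZero n
    n-nonZero = subst NonZero PQ≡n (^*^-nonZero m m)

  divisor : ℕ × ℕ → ℕ
  divisor (i , j) = P ^ i * Q ^ j

  idealOf : ℕ × ℕ → Vec Bool n
  idealOf x = multiplesOf n (divisor x)

  record ProperExponent (x : ℕ × ℕ) : Set where
    field
      fst≤m : proj₁ x ≤ m
      snd≤m : proj₂ x ≤ m
      ≢00   : x ≢ (0 , 0)
      ≢mm   : x ≢ (m , m)
  open ProperExponent public

  divisor∣n : ∀ {i j} → i ≤ m → j ≤ m → divisor (i , j) ∣ n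
  divisor∣n i≤m j≤m = subst (_ ∣_) PQ≡n (^*^-∣-^*^ i≤m j≤m)

  divisor-injective : ∀ {x y} → divisor x ≡ divisor y → x ≡ y
  divisor-injective {_ , _} {_ , _} eq = let i≡i′ , j≡j′ = ^*^-injective eq in cong₂ _,_ i≡i′ j≡j′

  divisor<n : ∀ {i j} → i ≤ m → j ≤ m → (i , j) ≢ (m , m) → divisor (i , j) < n
  divisor<n i≤m j≤m ≢mm with m≤n⇒m<n∨m≡n (∣⇒≤ (divisor∣n i≤m j≤m))
  ... | inj₁ lt = lt
  ... | inj₂ eq = ⊥-elim (≢mm (divisor-injective (trans eq (sym PQ≡n))))

  nonzeroIdeal≡idealOf : ∀ {J} → T (isIdeal n J) → T (isNonzero n J) →
                   ∃[ x ] proj₁ x ≤ m × proj₂ x ≤ m × x ≢ (m , m) × J ≡ idealOf x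
  nonzeroIdeal≡idealOf {J} J-ideal J-nonzero =
    let d , d∣n , _ , d<n , J≡ = Ideal.≡multiplesOf {n} {S = J} J-ideal J-nonzero
        i , j , i≤m , j≤m , d≡ = ∣^*^⇒ m m (subst (d ∣_) (sym PQ≡n) d∣n)
    in (i , j) , i≤m , j≤m , (λ ij≡mm → <⇒≢ d<n (trans d≡ (trans (cong divisor ij≡mm) PQ≡n))) ,
       trans J≡ (cong (multiplesOf n) d≡)

  vertex≡idealOf : ∀ {u} → u ∈ vertices n → ∃[ x ] ProperExponent x × u ≡ idealOf x
  vertex≡idealOf {u} u∈V =
    let u-ideal , u-nonzero , u-proper = ∈-vertices⁻ {S = u} u∈V
        x , i≤m , j≤m , ≢mm , u≡ = nonzeroIdeal≡idealOf u-ideal u-nonzero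
        x≢00 : x ≢ (0 , 0)
        x≢00 x≡00 = multiplesOf-1-improper {n} (subst (T ∘ isProper n) (trans u≡ (cong idealOf x≡00)) u-proper)
    in x , record { fst≤m = i≤m ; snd≤m = j≤m ; ≢00 = x≢00 ; ≢mm = ≢mm } , u≡

  idealOf∈vertices : ∀ {x} → ProperExponent x → idealOf x ∈ vertices n
  idealOf∈vertices {x} x! = ∈-vertices⁺ (multiplesOf-isIdeal n (divisor∣n (fst≤m x!) (snd≤m x!)))
    (multiplesOf-isNonzero 0<x x<n)
    (multiplesOf-isProper (≤-<-trans 0<x x<n) (≢00 x! ∘ divisor-injective))
    where
    0<x : 0 < divisor x
    0<x = >-nonZero⁻¹ (divisor x) {{^*^-nonZero (proj₁ x) (proj₂ x)}}
    x<n : divisor x < n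
    x<n = divisor<n (fst≤m x!) (snd≤m x!) (≢mm x!)

  idealOf-injective : ∀ {x y} → ProperExponent x → ProperExponent y → idealOf x ≡ idealOf y → x ≡ y
  idealOf-injective x! y! eq = divisor-injective
    (multiplesOf-injective (divisor<n (fst≤m x!) (snd≤m x!) (≢mm x!)) (divisor<n (fst≤m y!) (snd≤m y!) (≢mm y!)) eq)

  -- eℤₙ is the minimal ideal annihilated by P; it lies in idealOf (i , j) exactly when i < m.
  e : ℕ
  e = divisor (pred m , m)

  pred[m]<m : pred m < m
  pred[m]<m = ≤-reflexive (suc-pred m {{>-nonZero 0<m}})

  e<n : e < n
  e<n = divisor<n (pred[n]≤n {m}) ≤-refl (λ eq → <⇒≢ pred[m]<m (cong proj₁ eq))

  0<e : 0 < e
  0<e = >-nonZero⁻¹ e {{^*^-nonZero (pred m) m}}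

  idealOf-∋e : ∀ {i j} → i < m → j ≤ m → T (idealOf (i , j) ∋ e)
  idealOf-∋e {i} {j} i<m j≤m = multiplesOf-∋⁺ {n} {divisor (i , j)} e<n (^*^-∣-^*^ (<⇒≤pred i<m) j≤m)

  idealOf-∌e : ∀ {j} → ¬ T (idealOf (m , j) ∋ e)
  idealOf-∌e {j} m,j∋e =
    <⇒≱ pred[m]<m (proj₁ (^*^-∣⇒≤×≤ {m} {j} {pred m} {m} (multiplesOf-∋⁻ {n} {divisor (m , j)} e<n m,j∋e)))

  ∌e⇒P^m∣ : ∀ {J} → T (isIdeal n J) → T (isNonzero n J) → ¬ T (J ∋ e) → ∀ {z} → z < n → T (J ∋ z) → P ^ m ∣ z
  ∌e⇒P^m∣ {J} J-ideal J-nonzero J∌e {z} z<n z∈J =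
    let (i , j) , i≤m , j≤m , _ , J≡ = nonzeroIdeal≡idealOf {J} J-ideal J-nonzero
        m≤i : m ≤ i
        m≤i = ≮⇒≥ λ i<m → J∌e (subst (λ S → T (S ∋ e)) (sym J≡) (idealOf-∋e i<m j≤m))
    in ∣-trans (∣-trans (^-∣-^ P m≤i) (m∣m*n (Q ^ j)))
         (multiplesOf-∋⁻ {n} {divisor (i , j)} z<n (subst (λ S → T (S ∋ z)) J≡ z∈J))

  1<P^m : 1 < P ^ m
  1<P^m = <-≤-trans (nonTrivial⇒n>1 P {{prime⇒nonTrivial pP}}) (subst (_≤ P ^ m) (*-identityʳ P) (^-monoʳ-≤ P 0<m))

  ∌e⇒¬isEssential-⊕ : ∀ {I K} → T (isIdeal n I) → T (isNonzero n I) → T (isIdeal n K) → T (isNonzero n K) →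
                      ¬ T (I ∋ e) → ¬ T (K ∋ e) → ¬ T (isEssential n (I ⊕ K))
  ∌e⇒¬isEssential-⊕ {I} {K} I-ideal I-nonzero K-ideal K-nonzero I∌e K∌e =
    ⊕-¬isEssential {n} {P ^ m} {Q ^ m} {{n-nonZero}} {{m^n≢0 Q m}} (^⊥^ m m) PQ≡n 1<P^m I K
      (∌e⇒P^m∣ {I} I-ideal I-nonzero I∌e) (∌e⇒P^m∣ {K} K-ideal K-nonzero K∌e)

  private
    _≟²_ : DecidableEquality (ℕ × ℕ)
    _≟²_ = ×-≡-dec _≟_ _≟_

    grid : List (ℕ × ℕ)
    grid = cartesianProduct (upTo (suc m)) (upTo (suc m))

    grid-Unique : Unique grid
    grid-Unique = Unique.cartesianProduct⁺ (Unique.upTo⁺ (suc m)) (Unique.upTo⁺ (suc m))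

    ∈-grid⁺ : ∀ {i j} → i ≤ m → j ≤ m → (i , j) ∈ grid
    ∈-grid⁺ i≤m j≤m = ∈-cartesianProduct⁺ (∈-upTo⁺ (s≤s i≤m)) (∈-upTo⁺ (s≤s j≤m))

    ∈-grid⁻ : ∀ {i j} → (i , j) ∈ grid → i ≤ m × j ≤ m
    ∈-grid⁻ ij∈ = let i∈ , j∈ = ∈-cartesianProduct⁻ (upTo (suc m)) (upTo (suc m)) ij∈
                  in s≤s⁻¹ (∈-upTo⁻ i∈) , s≤s⁻¹ (∈-upTo⁻ j∈)

    isProperExponent? : Decidable (λ x → x ≢ (0 , 0) × x ≢ (m , m))
    isProperExponent? x = ¬? (x ≟² (0 , 0)) ×-dec ¬? (x ≟² (m , m))

  exponents : List (ℕ × ℕ)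
  exponents = filter isProperExponent? grid

  ∈-exponents⁺ : ∀ {x} → ProperExponent x → x ∈ exponents
  ∈-exponents⁺ {i , j} x! = ∈-filter⁺ isProperExponent? (∈-grid⁺ (fst≤m x!) (snd≤m x!)) (≢00 x! , ≢mm x!)

  ∈-exponents⁻ : ∀ {x} → x ∈ exponents → ProperExponent x
  ∈-exponents⁻ {i , j} x∈ with x∈grid , ≢00 , ≢mm ← ∈-filter⁻ isProperExponent? {xs = grid} x∈ =
    let i≤m , j≤m = ∈-grid⁻ x∈grid in record { fst≤m = i≤m ; snd≤m = j≤m ; ≢00 = ≢00 ; ≢mm = ≢mm }

  exponents-Unique : Unique exponents
  exponents-Unique = Unique.filter⁺ isProperExponent? grid-Unique

  length-exponents : length exponents + 2 ≡ suc m * suc m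
  length-exponents = begin
    length exponents + 2                       ≡⟨ +-comm (length exponents) 2 ⟩
    length ((0 , 0) ∷ (m , m) ∷ exponents)     ≡⟨ Unique-set⇒length≡ extended-Unique grid-Unique from to ⟩
    length grid                                ≡⟨ length-cartesianProduct (upTo (suc m)) (upTo (suc m)) ⟩
    length (upTo (suc m)) * length (upTo (suc m)) ≡⟨ cong₂ _*_ (length-upTo (suc m)) (length-upTo (suc m)) ⟩
    suc m * suc m                              ∎
    where
    open ≡-Reasoning
    extended-Unique : Unique ((0 , 0) ∷ (m , m) ∷ exponents)
    extended-Unique =
      ((λ 00≡mm → <⇒≢ 0<m (cong proj₁ 00≡mm)) All.∷ All.tabulate (λ x∈ 00≡x → ≢00 (∈-exponents⁻ x∈) (sym 00≡x)))
      AllPairs.∷ (All.tabulate (λ x∈ mm≡x → ≢mm (∈-exponents⁻ x∈) (sym mm≡x)) AllPairs.∷ exponents-Unique)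
    from : ∀ {x} → x ∈ (0 , 0) ∷ (m , m) ∷ exponents → x ∈ grid
    from (here refl)         = ∈-grid⁺ z≤n z≤n
    from (there (here refl)) = ∈-grid⁺ ≤-refl ≤-refl
    from (there (there x∈))  = proj₁ (∈-filter⁻ isProperExponent? {xs = grid} x∈)
    to : ∀ {x} → x ∈ grid → x ∈ (0 , 0) ∷ (m , m) ∷ exponents
    to {x} x∈grid with x ≟² (0 , 0) | x ≟² (m , m)
    ... | yes x≡00 | _        = here x≡00
    ... | no _     | yes x≡mm = there (here x≡mm)
    ... | no x≢00  | no x≢mm  = there (there (∈-filter⁺ isProperExponent? x∈grid (x≢00 , x≢mm)))

  length-vertices : length (vertices n) ≡ length exponents
  length-vertices =
    trans (Unique-set⇒length≡ (vertices-Unique n) (Unique-map⁺ idealOf exponents-Unique injective) to from)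
          (length-map idealOf exponents)
    where
    injective : ∀ {x y} → x ∈ exponents → y ∈ exponents → idealOf x ≡ idealOf y → x ≡ y
    injective x∈ y∈ = idealOf-injective (∈-exponents⁻ x∈) (∈-exponents⁻ y∈)
    to : ∀ {u} → u ∈ vertices n → u ∈ map idealOf exponents
    to u∈V = let x , x! , u≡ = vertex≡idealOf u∈V in
      subst (_∈ map idealOf exponents) (sym u≡) (∈-map⁺ idealOf (∈-exponents⁺ x!))
    from : ∀ {u} → u ∈ map idealOf exponents → u ∈ vertices n
    from u∈ = let x , x∈ , u≡ = ∈-map⁻ idealOf u∈ in
      subst (_∈ vertices n) (sym u≡) (idealOf∈vertices (∈-exponents⁻ x∈))

  count-∌e : count (λ u → not (u ∋ e)) (vertices n) ≡ m
  count-∌e =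
    trans (Unique-set⇒length≡ (Unique.filter⁺ (T? ∘ ∌e) (vertices-Unique n)) (Unique-map⁺ top (Unique.upTo⁺ m) injective)
                              to from)
          (trans (length-map top (upTo m)) (length-upTo m))
    where
    ∌e : Vec Bool n → Bool
    ∌e u = not (u ∋ e)
    top : ℕ → Vec Bool n
    top j = idealOf (m , j)
    top-proper : ∀ {j} → j < m → ProperExponent (m , j)
    top-proper j<m = record { fst≤m = ≤-refl ; snd≤m = <⇒≤ j<m
                            ; ≢00 = λ mj≡00 → <⇒≢ 0<m (sym (cong proj₁ mj≡00))
                            ; ≢mm = λ mj≡mm → <⇒≢ j<m (cong proj₂ mj≡mm) }
    injective : ∀ {j k} → j ∈ upTo m → k ∈ upTo m → top j ≡ top k → j ≡ k
    injective j∈ k∈ eq = cong proj₂ (idealOf-injective (top-proper (∈-upTo⁻ j∈)) (top-proper (∈-upTo⁻ k∈)) eq)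
    to : ∀ {u} → u ∈ filterᵇ ∌e (vertices n) → u ∈ map top (upTo m)
    to {u} u∈ =
      let u∈V , u∌e = ∈-filter⁻ (T? ∘ ∌e) {xs = vertices n} u∈
          (i , j) , x! , u≡ = vertex≡idealOf {u} u∈V
          i≡m : i ≡ m
          i≡m = ≤-antisym (fst≤m x!) (≮⇒≥ λ i<m →
                  T-not⁻ {u ∋ e} u∌e (subst (λ S → T (S ∋ e)) (sym u≡) (idealOf-∋e i<m (snd≤m x!))))
          j<m : j < m
          j<m = ≤∧≢⇒< (snd≤m x!) (λ j≡m → ≢mm x! (cong₂ _,_ i≡m j≡m))
      in subst (_∈ map top (upTo m)) (sym (trans u≡ (cong (λ i → idealOf (i , j)) i≡m))) (∈-map⁺ top (∈-upTo⁺ j<m))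
    from : ∀ {u} → u ∈ map top (upTo m) → u ∈ filterᵇ ∌e (vertices n)
    from u∈ = let j , j∈ , u≡ = ∈-map⁻ top u∈ in subst (_∈ filterᵇ ∌e (vertices n)) (sym u≡)
      (∈-filter⁺ (T? ∘ ∌e) (idealOf∈vertices (top-proper (∈-upTo⁻ j∈))) (T-not⁺ {top j ∋ e} (idealOf-∌e {j})))

-- For m = k + 1 the vertex count L = (m + 1)² − 2 is k² + 4k + 2, which keeps the computation subtraction-free.
wiener-arithmetic : ∀ {m L W} → 0 < m → L + 2 ≡ suc m * suc m → 2 * W + L + 2 * m ≡ L * L + 2 * (m * m) →
                    2 * W + 8 * m ≡ m ^ 4 + 4 * m ^ 3 + 3 * m ^ 2 + 2
wiener-arithmetic {suc k} {L} {W} _ L+2≡ 2W+L+2m≡ = +-cancelʳ-≡ (L + 2 * m) _ _ (begin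
  2 * W + 8 * m + (L + 2 * m)                ≡⟨ regroup W L m ⟩
  2 * W + L + 2 * m + 8 * m                  ≡⟨ cong (_+ 8 * m) 2W+L+2m≡ ⟩
  L * L + 2 * (m * m) + 8 * m                ≡⟨ cong (λ L → L * L + 2 * (m * m) + 8 * m) L≡ ⟩
  L′ * L′ + 2 * (m * m) + 8 * m              ≡⟨ expand k ⟩
  m ^ 4 + 4 * m ^ 3 + 3 * m ^ 2 + 2 + (L′ + 2 * m)
    ≡⟨ cong (λ L → m ^ 4 + 4 * m ^ 3 + 3 * m ^ 2 + 2 + (L + 2 * m)) (sym L≡) ⟩
  m ^ 4 + 4 * m ^ 3 + 3 * m ^ 2 + 2 + (L + 2 * m)  ∎)
  where
  open ≡-Reasoning
  m L′ : ℕ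
  m = suc k
  L′ = k * k + 4 * k + 2
  square : ∀ k → (2 + k) * (2 + k) ≡ k * k + 4 * k + 2 + 2
  square = solve-∀
  L≡ : L ≡ L′
  L≡ = +-cancelʳ-≡ 2 L L′ (trans L+2≡ (square k))
  regroup : ∀ W L m → 2 * W + 8 * m + (L + 2 * m) ≡ 2 * W + L + 2 * m + 8 * m
  regroup = solve-∀
  expand : ∀ k → (k * k + 4 * k + 2) * (k * k + 4 * k + 2) + 2 * ((1 + k) * (1 + k)) + 8 * (1 + k)
                 ≡ (1 + k) * ((1 + k) * ((1 + k) * ((1 + k) * 1))) + 4 * ((1 + k) * ((1 + k) * ((1 + k) * 1)))
                   + 3 * ((1 + k) * ((1 + k) * 1)) + 2 + (k * k + 4 * k + 2 + 2 * (1 + k))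
  expand = solve-∀

module EssentialIdealGraph {p q m : ℕ} (pp : Prime p) (pq : Prime q) (p≢q : p ≢ q) (1<m : 1 < m) where

  n : ℕ
  n = p ^ m * q ^ m

  private
    0<m : 0 < m
    0<m = <-trans (s≤s z≤n) 1<m

  module Sp = Side pp pq p≢q refl 0<m
  module Sq = Side pq pp (p≢q ∘ sym) (*-comm (q ^ m) (p ^ m)) 0<m
  open Sp using (n-nonZero)

  e₁ e₂ : ℕ
  e₁ = Sp.e
  e₂ = Sq.e

  nonzeroIdeal-∋e₁∨e₂ : ∀ {J} → T (isIdeal n J) → T (isNonzero n J) → T (J ∋ e₁ ∨ J ∋ e₂)
  nonzeroIdeal-∋e₁∨e₂ {J} J-ideal J-nonzero = T-∨-stable λ J∌e₁ J∌e₂ →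
    let z , z<n , 0<z , z∈J = isNonzero⁻ {S = J} J-nonzero
    in <⇒≢ 0<z (sym (∣-coprime-product⇒≡0 (PrimePowers.^⊥^ pp pq p≢q m m)
         (Sp.∌e⇒P^m∣ {J} J-ideal J-nonzero J∌e₁ z<n z∈J) (Sq.∌e⇒P^m∣ {J} J-ideal J-nonzero J∌e₂ z<n z∈J) z<n))

  ∋e₁∧∋e₂⇒isEssential : ∀ {I} → T (I ∋ e₁) → T (I ∋ e₂) → T (isEssential n I)
  ∋e₁∧∋e₂⇒isEssential {I} I∋e₁ I∋e₂ = isEssential⁺ {I = I} λ {J} J-ideal J-nonzero →
    [ (λ J∋e₁ → e₁ , Sp.e<n , Sp.0<e , I∋e₁ , J∋e₁) , (λ J∋e₂ → e₂ , Sq.e<n , Sq.0<e , I∋e₂ , J∋e₂) ]′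
      (T-∨⁻ {J ∋ e₁} (nonzeroIdeal-∋e₁∨e₂ {J} J-ideal J-nonzero))

  private
    V : List (Vec Bool n)
    V = vertices n

  adj≡ : ∀ {u v} → u ∈ V → v ∈ V → u ≢ v → adj n u v ≡ (u ∋ e₁ ∨ v ∋ e₁) ∧ (u ∋ e₂ ∨ v ∋ e₂)
  adj≡ {u} {v} u∈V v∈V u≢v =
    trans (cong (λ b → not b ∧ isEssential n (u ⊕ v)) (eqV-false u≢v)) (T-injective essential⇒ ⇒essential)
    where
    u-ideal : T (isIdeal n u)
    u-ideal = proj₁ (∈-vertices⁻ {S = u} u∈V)
    u-nonzero : T (isNonzero n u)
    u-nonzero = proj₁ (proj₂ (∈-vertices⁻ {S = u} u∈V))
    v-ideal : T (isIdeal n v)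
    v-ideal = proj₁ (∈-vertices⁻ {S = v} v∈V)
    v-nonzero : T (isNonzero n v)
    v-nonzero = proj₁ (proj₂ (∈-vertices⁻ {S = v} v∈V))
    essential⇒ : T (isEssential n (u ⊕ v)) → T ((u ∋ e₁ ∨ v ∋ e₁) ∧ (u ∋ e₂ ∨ v ∋ e₂))
    essential⇒ ess = T-∧⁺
      (T-∨-stable λ u∌e₁ v∌e₁ → Sp.∌e⇒¬isEssential-⊕ {u} {v} u-ideal u-nonzero v-ideal v-nonzero u∌e₁ v∌e₁ ess)
      (T-∨-stable λ u∌e₂ v∌e₂ → Sq.∌e⇒¬isEssential-⊕ {u} {v} u-ideal u-nonzero v-ideal v-nonzero u∌e₂ v∌e₂ ess)
    ⇒essential : T ((u ∋ e₁ ∨ v ∋ e₁) ∧ (u ∋ e₂ ∨ v ∋ e₂)) → T (isEssential n (u ⊕ v))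
    ⇒essential t =
      let t₁ , t₂ = T-∧⁻ {u ∋ e₁ ∨ v ∋ e₁} t
          0∈u = Ideal.0∈ {n} {S = u} u-ideal
          0∈v = Ideal.0∈ {n} {S = v} v-ideal
      in ∋e₁∧∋e₂⇒isEssential {u ⊕ v} (⊆-⊕-∨ u v Sp.e<n 0∈u 0∈v t₁) (⊆-⊕-∨ u v Sq.e<n 0∈u 0∈v t₂)

  covers : ∀ {u} → u ∈ V → T (u ∋ e₁ ∨ u ∋ e₂)
  covers {u} u∈V = let u-ideal , u-nonzero , _ = ∈-vertices⁻ {S = u} u∈V in nonzeroIdeal-∋e₁∨e₂ {u} u-ideal u-nonzero

  w : Vec Bool n
  w = Sp.idealOf (1 , 1)

  w∈V : w ∈ V
  w∈V = Sp.idealOf∈vertices (record { fst≤m = <⇒≤ 1<m ; snd≤m = <⇒≤ 1<m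
                                     ; ≢00 = λ () ; ≢mm = λ 11≡mm → <⇒≢ 1<m (cong proj₁ 11≡mm) })

  w∋e₁ : T (w ∋ e₁)
  w∋e₁ = Sp.idealOf-∋e 1<m (<⇒≤ 1<m)

  w∋e₂ : T (w ∋ e₂)
  w∋e₂ = subst (λ S → T (S ∋ e₂)) (cong (multiplesOf n) (*-comm (q ^ 1) (p ^ 1))) (Sq.idealOf-∋e 1<m (<⇒≤ 1<m))

  open TwoWitnesses e₁ e₂ adj≡ covers w∈V w∋e₁ w∋e₂

  length-vertices : length V + 2 ≡ suc m * suc m
  length-vertices = trans (cong (_+ 2) Sp.length-vertices) Sp.length-exponents

  2<|V| : 2 < length V
  2<|V| = +-cancelʳ-≤ 2 3 (length V)
    (≤-trans (s≤s (s≤s (s≤s (s≤s (s≤s z≤n))))) (≤-trans 3*3≤ (≤-reflexive (sym length-vertices))))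
    where
    3*3≤ : 3 * 3 ≤ suc m * suc m
    3*3≤ = *-mono-≤ (s≤s 1<m) (s≤s 1<m)

  connected≡true : connected n ≡ true
  connected≡true = Equivalence.to T-≡ (T-all⁺ _ (pairs V) λ {(u , v)} uv∈ →
    let u∈V , v∈V , u≢v = pairs-∈ (vertices-Unique n) uv∈
    in subst (λ k → T (reach n k u v)) (m∸n+n≡m (<⇒≤ 2<|V|))
         (reach-+ {n} (length V ∸ 2) {2} {u} {v} (reach-2-all u∈V v∈V u≢v)))

  private
    ∌e₁ ∌e₂ : Vec Bool n → Bool
    ∌e₁ u = not (u ∋ e₁)
    ∌e₂ u = not (u ∋ e₂)

  wiener≡ : wiener n ≡ pairCount (λ _ → true) V + pairCount ∌e₁ V + pairCount ∌e₂ V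
  wiener≡ = begin
    wiener n                                                 ≡⟨ cong sum (map-cong-local (All.tabulate dist-pair)) ⟩
    sum (map (λ uv → F₀ uv + F₁ uv + F₂ uv) (pairs V))       ≡⟨ sum-map-+ (λ uv → F₀ uv + F₁ uv) F₂ (pairs V) ⟩
    sum (map (λ uv → F₀ uv + F₁ uv) (pairs V)) + pairCount ∌e₂ V
      ≡⟨ cong (_+ pairCount ∌e₂ V) (sum-map-+ F₀ F₁ (pairs V)) ⟩
    pairCount (λ _ → true) V + pairCount ∌e₁ V + pairCount ∌e₂ V ∎
    where
    open ≡-Reasoning
    F₀ F₁ F₂ : Vec Bool n × Vec Bool n → ℕ
    F₀ _       = 1
    F₁ (u , v) = indicator (∌e₁ u ∧ ∌e₁ v)
    F₂ (u , v) = indicator (∌e₂ u ∧ ∌e₂ v)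
    dist-pair : ∀ {uv} → uv ∈ pairs V → dist n (proj₁ uv) (proj₂ uv) ≡ F₀ uv + F₁ uv + F₂ uv
    dist-pair {u , v} uv∈ = let u∈V , v∈V , u≢v = pairs-∈ (vertices-Unique n) uv∈ in dist≡ u∈V v∈V u≢v 2<|V|

  2*wiener : 2 * wiener n + length V + 2 * m ≡ length V * length V + 2 * (m * m)
  2*wiener = begin
    2 * wiener n + length V + 2 * m                            ≡⟨ cong (λ W → 2 * W + length V + 2 * m) wiener≡ ⟩
    2 * (S₀ + S₁ + S₂) + length V + 2 * m                      ≡⟨ regroup S₀ S₁ S₂ (length V) m ⟩
    (2 * S₀ + length V) + (2 * S₁ + m) + (2 * S₂ + m)          ≡⟨ cong₂ _+_ (cong₂ _+_ pairs₀ pairs₁) pairs₂ ⟩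
    length V * length V + m * m + m * m                        ≡⟨ double (length V * length V) (m * m) ⟩
    length V * length V + 2 * (m * m)                          ∎
    where
    open ≡-Reasoning
    S₀ = pairCount (λ _ → true) V
    S₁ = pairCount ∌e₁ V
    S₂ = pairCount ∌e₂ V
    regroup : ∀ S₀ S₁ S₂ L m → 2 * (S₀ + S₁ + S₂) + L + 2 * m ≡ (2 * S₀ + L) + (2 * S₁ + m) + (2 * S₂ + m)
    regroup = solve-∀
    double : ∀ a b → a + b + b ≡ a + 2 * b
    double = solve-∀
    count-true : count (λ _ → true) V ≡ length V
    count-true = cong length (filter-all (T? ∘ λ _ → true) (All.universal (λ _ → _) V))
    pairs₀ : 2 * S₀ + length V ≡ length V * length V
    pairs₀ = subst (λ c → 2 * S₀ + c ≡ c * c) count-true (2*pairCount+count≡count² (λ _ → true) V)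
    pairs₁ : 2 * S₁ + m ≡ m * m
    pairs₁ = subst (λ c → 2 * S₁ + c ≡ c * c) Sp.count-∌e (2*pairCount+count≡count² ∌e₁ V)
    pairs₂ : 2 * S₂ + m ≡ m * m
    pairs₂ = subst (λ c → 2 * S₂ + c ≡ c * c) Sq.count-∌e (2*pairCount+count≡count² ∌e₂ V)

mainTheorem14 : (p q m : ℕ) → Prime p → Prime q → p ≢ q → 1 < m →
    connected (p ^ m * q ^ m) ≡ true
    × 2 * wiener (p ^ m * q ^ m) + 8 * m ≡ m ^ 4 + 4 * m ^ 3 + 3 * m ^ 2 + 2
mainTheorem14 p q m pp pq p≢q 1<m =
  connected≡true ,
  wiener-arithmetic {m} {length (vertices n)} {wiener n} (<-trans (s≤s z≤n) 1<m) length-vertices 2*wiener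
  where open EssentialIdealGraph pp pq p≢q 1<m
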